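{- Let $\lambda$ be a weak composition and $\kappa$ a weak komposition. Then $\kappa$ is the kontent of a set-valued weak composition tableau of shape $\lambda$ if and only if $\kappa$ is a glide of $\lambda$.
   Context: A weak composition is a finite sequence of nonnegative integers; a weak komposition is a weak composition in which some nonzero entries are marked bold; the excess of a (segment of a) weak komposition is its number of bold entries. The diagram of $\lambda$ has $\lambda_r$ left-justified boxes in row $r$, totally ordered lexicographically ($(r,c)<(r',c')$ iff $r<r'$, or $r=r'$ and $c<c'$). A weak composition tableau of shape $\lambda$ is a map $f$ from boxes to positive integers, weakly order-preserving for this order, such that every entry in row $r$ is strictly smaller than every entry in row $r'$ whenever $r<r'$, and every entry in row $r$ is at most $r$. A set-valued weak composition tableau of shape $\lambda$ is a finite set $T\subseteq\lambda\times\mathbb Z_{>0}$ such that every box $b$ lies in at least one pair $(b,i)\in T$ and every function $f$ on the boxes whose graph is contained in $T$ is a weak composition tableau of shape $\lambda$. The kontent of $T$ is the weak komposition $\kappa$ with $\kappa_j=\#\{b:(b,j)\in T\}$, where $\kappa_j$ is bold iff there is a box $b$ and some $i<j$ with $(b,i),(b,j)\in T$. If $\lambda$ has its nonzero entries at positions $n_1<\dots<n_l$, a weak komposition $\kappa$ is a glide of $\lambda$ if there are $0=i_0<i_1<\dots<i_l$ with $\kappa_m=0$ for $m>i_l$ such that for each $j\in\{1,\dots,l\}$: (1) $\kappa_{i_{j-1}+1}+\dots+\kappa_{i_j}=\lambda_{n_j}+\mathrm{excess}(\kappa_{i_{j-1}+1},\dots,\kappa_{i_j})$; (2) $i_j\le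 n_j$; (3) the first nonzero entry among $\kappa_{i_{j-1}+1},\dots,\kappa_{i_j}$ is not bold. -}

module Defs where

open import Data.Nat using (ℕ; zero; suc; _+_; _≤_; _<_; _∸_)
open import Data.Nat.Properties using (_≟_)
open import Data.Bool using (Bool; true; false)
open import Data.List using (List; []; _∷_; length; map; upTo; filter; concatMap)
open import Data.Nat.ListAction using (sum)
open import Data.Product using (_×_; _,_; proj₁; proj₂; ∃-syntax)
open import Data.Product.Properties using (≡-dec)
open import Data.Sum using (_⊎_)
open import Data.Empty using (⊥)
open import Relation.Binary.PropositionalEquality using (_≡_; _≢_)
open import Data.List.Membership.Propositional using (_∈_)
import Data.List.Membership.DecPropositional as DecMem
open import Data.List.Relation.Unary.All using (All)

WeakComposition : Set
WeakComposition = List ℕ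

-- A weak komposition: entries together with a flag "bold".
WeakKomposition : Set
WeakKomposition = List (ℕ × Bool)

IsWeakKomposition : WeakKomposition → Set
IsWeakKomposition κ = All (λ e → proj₂ e ≡ true → proj₁ e ≢ 0) κ

lookupD : {A : Set} → A → List A → ℕ → A
lookupD d [] _ = d
lookupD d (x ∷ xs) zero = x
lookupD d (x ∷ xs) (suc n) = lookupD d xs n

-- 1-based entry of a weak composition; 0 outside the range 1..length
entry : WeakComposition → ℕ → ℕ
entry xs zero = 0
entry xs (suc n) = lookupD 0 xs n

kval : WeakKomposition → ℕ → ℕ
kval κ m = entry (map proj₁ κ) m

kbold : WeakKomposition → ℕ → Bool
kbold κ zero = false
kbold κ (suc n) = lookupD false (map proj₂ κ) n

InShape : WeakComposition → ℕ → ℕ → Set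
InShape la r c = (1 ≤ r) × (1 ≤ c) × (c ≤ entry la r)

BoxLe : ℕ → ℕ → ℕ → ℕ → Set
BoxLe r c r' c' = (r < r') ⊎ ((r ≡ r') × (c ≤ c'))

IsWCT : WeakComposition → (ℕ → ℕ → ℕ) → Set
IsWCT la f =
  (∀ r c → InShape la r c → 1 ≤ f r c)
  × (∀ r c r' c' → InShape la r c → InShape la r' c' → BoxLe r c r' c' → f r c ≤ f r' c')
  × (∀ r c r' c' → InShape la r c → InShape la r' c' → r < r' → f r c < f r' c')
  × (∀ r c → InShape la r c → f r c ≤ r)

-- a finite set of triples (row , column , value)
Entries : Set
Entries = List (ℕ × ℕ × ℕ)

IsSVWCT : WeakComposition → Entries → Set
IsSVWCT la T =
  All (λ t → InShape la (proj₁ t) (proj₁ (proj₂ t)) × (1 ≤ proj₂ (proj₂ t))) T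
  × (∀ r c → InShape la r c → ∃[ i ] ((r , c , i) ∈ T))
  × (∀ (f : ℕ → ℕ → ℕ) → (∀ r c → InShape la r c → (r , c , f r c) ∈ T) → IsWCT la f)

range1 : ℕ → List ℕ
range1 n = map suc (upTo n)

boxes : WeakComposition → List (ℕ × ℕ)
boxes la = concatMap (λ r → map (λ c → (r , c)) (range1 (entry la r))) (range1 (length la))

open DecMem (≡-dec _≟_ (≡-dec _≟_ _≟_)) using (_∈?_)

kontentCount : WeakComposition → Entries → ℕ → ℕ
kontentCount la T j = length (filter (λ b → (proj₁ b , proj₂ b , j) ∈? T) (boxes la))

BoldAt : Entries → ℕ → Set
BoldAt T j = ∃[ r ] ∃[ c ] ∃[ i ] ((i < j) × ((r , c , i) ∈ T) × ((r , c , j) ∈ T))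

-- κ is the kontent of T (κ_j compared for every j ≥ 1, κ padded by non-bold zeros)
IsKontent : WeakComposition → Entries → WeakKomposition → Set
IsKontent la T κ = ∀ j → 1 ≤ j →
  (kval κ j ≡ kontentCount la T j)
  × (kbold κ j ≡ true → BoldAt T j)
  × (BoldAt T j → kbold κ j ≡ true)

npos : ℕ → WeakComposition → List (ℕ × ℕ)
npos k [] = []
npos k (zero ∷ xs) = npos (suc k) xs
npos k (suc v ∷ xs) = (k , suc v) ∷ npos (suc k) xs

nonzeroPositions : WeakComposition → List (ℕ × ℕ)
nonzeroPositions la = npos 1 la

segment : ℕ → ℕ → List ℕ
segment a b = map (λ t → suc (a + t)) (upTo (b ∸ a))

segSum : WeakKomposition → ℕ → ℕ → ℕ
segSum κ a b = sum (map (kval κ) (segment a b))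

boolToℕ : Bool → ℕ
boolToℕ true = 1
boolToℕ false = 0

excess : WeakKomposition → ℕ → ℕ → ℕ
excess κ a b = sum (map (λ m → boolToℕ (kbold κ m)) (segment a b))

FirstNonzeroNotBold : WeakKomposition → ℕ → ℕ → Set
FirstNonzeroNotBold κ a b = ∀ m → a < m → m ≤ b → kval κ m ≢ 0 →
  (∀ m' → a < m' → m' < m → kval κ m' ≡ 0) → kbold κ m ≡ false

-- cut points i_1 < … < i_l (after prev = i_{j-1}) for the nonzero parts (n_j , λ_{n_j})
GlideCuts : WeakKomposition → ℕ → List (ℕ × ℕ) → List ℕ → Set
GlideCuts κ prev [] [] = ∀ m → prev < m → kval κ m ≡ 0
GlideCuts κ prev [] (_ ∷ _) = ⊥
GlideCuts κ prev (_ ∷ _) [] = ⊥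
GlideCuts κ prev ((n , v) ∷ ns) (i ∷ is) =
  (prev < i)
  × (segSum κ prev i ≡ v + excess κ prev i)
  × (i ≤ n)
  × FirstNonzeroNotBold κ prev i
  × GlideCuts κ i ns is

IsGlide : WeakComposition → WeakKomposition → Set
IsGlide la κ = ∃[ is ] GlideCuts κ 0 (nonzeroPositions la) is

{-# OPTIONS --safe #-}
-- In a set-valued tableau the values of a nonzero row n_j form an interval (i_{j-1} , i_j] of values
-- that occur in no other row, the cut i_j being the largest value of the row. Sweeping through that
-- interval, value m is held by κ_m boxes of the row; by weak increase along the row at most one of
-- them already held a smaller value of the interval, and one does exactly when m is bold. So the
-- λ_{n_j} boxes of the row are counted as κ_{i_{j-1}+1} + … + κ_{i_j} minus the excess.
-- Conversely, given a glide, lay the values of the j-th piece out left to right in row n_j, value m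
-- taking κ_m consecutive columns, a bold value starting in the last column of its predecessor. The
-- sum condition makes the row exactly full, and a bold value always has a predecessor in its piece
-- because the first nonzero value of a piece is not bold.
module Submission where

open import Defs
open import Data.Bool using (true; false)
open import Data.Bool.Properties using (¬-not)
open import Data.List using (List; []; _∷_; _++_; _∷ʳ_; length; map; filter; concatMap; upTo; applyUpTo)
open import Data.List.Extrema.Nat using (argmax; argmax-all; f[xs]≤f[argmax])
open import Data.List.Membership.Propositional using (_∈_; lose; find)
open import Data.List.Membership.Propositional.Properties
  using (∈-filter⁺; ∈-filter⁻; ∈-map⁺; ∈-map⁻; ∈-upTo⁺; ∈-upTo⁻; ∈-concatMap⁺; ∈-++⁺ˡ; ∈-++⁺ʳ; ∈-++⁻)
import Data.List.Membership.DecPropositional as DecMembership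
open import Data.List.Properties
  using ( length-++; length-map; length-upTo; filter-++; filter-none; filter-all; filter-some; map-++; map-∘
        ; upTo-∷ʳ; map-upTo; ++-identityʳ; ++-assoc; concatMap-map; map-concatMap; concatMap-cong)
open import Data.List.Relation.Unary.All as All using (All; []; _∷_)
open import Data.List.Relation.Unary.AllPairs using (AllPairs; []; _∷_)
open import Data.List.Relation.Unary.Any using (Any; here; there; any?)
open import Data.List.Relation.Unary.Any.Properties using (++⁺ˡ; ++⁺ʳ; ++⁻)
open import Data.Nat using (ℕ; zero; suc; pred; _+_; _∸_; _≤_; _<_; _≤?_; _<?_; _≤′_; ≤′-refl; ≤′-step; z≤n; s≤s)
open import Data.Nat.ListAction using (sum)
open import Data.Nat.ListAction.Properties using (sum-++)
open import Data.Nat.Properties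
open import Algebra.Properties.CommutativeSemigroup +-commutativeSemigroup
  using (x∙yz≈xz∙y; xy∙z≈xz∙y; interchange)
open import Data.Product using (_×_; _,_; proj₁; proj₂; ∃-syntax; map₁)
import Data.Product as Product
open import Data.Product.Properties using (≡-dec)
open import Data.Sum using (_⊎_; inj₁; inj₂; [_,_]′)
import Data.Sum as Sum
open import Function using (_∘_)
open import Function.Bundles using (_⇔_; mk⇔; Equivalence)
open import Level using (0ℓ)
open import Relation.Binary.Definitions using (tri<; tri≈; tri>)
open import Relation.Binary.PropositionalEquality
open import Relation.Nullary using (Dec; yes; no; ¬_; contradiction; _×-dec_)
open import Relation.Unary using (Pred; Decidable; _∪_; _∩_)
open import Relation.Unary.Properties using (_∪?_; _∩?_)

open DecMembership (≡-dec _≟_ (≡-dec _≟_ _≟_)) using (_∈?_)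

count : {A : Set} {P : Pred A 0ℓ} → Decidable P → List A → ℕ
count P? xs = length (filter P? xs)

module _ {A : Set} {P : Pred A 0ℓ} (P? : Decidable P) where

  count-++ : ∀ xs ys → count P? (xs ++ ys) ≡ count P? xs + count P? ys
  count-++ xs ys = trans (cong length (filter-++ P? xs ys)) (length-++ (filter P? xs))

  count-none : ∀ xs → (∀ {x} → x ∈ xs → ¬ P x) → count P? xs ≡ 0
  count-none _ ¬p = cong length (filter-none P? (All.tabulate ¬p))

  count-all : ∀ xs → (∀ {x} → x ∈ xs → P x) → count P? xs ≡ length xs
  count-all _ p = cong length (filter-all P? (All.tabulate p))

  count-pos : ∀ {x xs} → x ∈ xs → P x → 0 < count P? xs
  count-pos x∈xs px = filter-some P? (lose x∈xs px)

  count-map : ∀ {B : Set} (f : B → A) xs → count P? (map f xs) ≡ count (P? ∘ f) xs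
  count-map f [] = refl
  count-map f (x ∷ xs) with P? (f x)
  ... | yes _ = cong suc (count-map f xs)
  ... | no _ = count-map f xs

module _ {A : Set} {P Q : Pred A 0ℓ} (P? : Decidable P) (Q? : Decidable Q) where

  count-cong : ∀ xs → (∀ {x} → x ∈ xs → P x ⇔ Q x) → count P? xs ≡ count Q? xs
  count-cong [] _ = refl
  count-cong (x ∷ xs) P⇔Q with P? x | Q? x
  ... | yes _ | yes _ = cong suc (count-cong xs (P⇔Q ∘ there))
  ... | no _  | no _  = count-cong xs (P⇔Q ∘ there)
  ... | yes p | no ¬q = contradiction (Equivalence.to (P⇔Q (here refl)) p) ¬q
  ... | no ¬p | yes q = contradiction (Equivalence.from (P⇔Q (here refl)) q) ¬p

  count-∪-∩ : ∀ xs → count (P? ∪? Q?) xs + count (P? ∩? Q?) xs ≡ count P? xs + count Q? xs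
  count-∪-∩ [] = refl
  count-∪-∩ (x ∷ xs) with P? x | Q? x | count-∪-∩ xs
  ... | yes _ | yes _ | ih = cong suc (trans (+-suc _ _) (trans (cong suc ih) (sym (+-suc _ _))))
  ... | yes _ | no _  | ih = cong suc ih
  ... | no _  | yes _ | ih = trans (cong suc ih) (sym (+-suc _ _))
  ... | no _  | no _  | ih = ih

InInterval : ℕ → ℕ → Pred ℕ 0ℓ
InInterval a b m = a < m × m ≤ b

inInterval? : ∀ a b → Decidable (InInterval a b)
inInterval? a b m = (a <? m) ×-dec (m ≤? b)

segment-self : ∀ a → segment a a ≡ []
segment-self a = cong (map (λ t → suc (a + t)) ∘ upTo) (n∸n≡0 a)

segment-∷ʳ : ∀ {a b} → a ≤ b → segment a (suc b) ≡ segment a b ∷ʳ suc b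
segment-∷ʳ {a} {b} a≤b = begin
  map f (upTo (suc b ∸ a))          ≡⟨ cong (map f ∘ upTo) (+-∸-assoc 1 a≤b) ⟩
  map f (upTo (suc (b ∸ a)))        ≡⟨ cong (map f) (upTo-∷ʳ (b ∸ a)) ⟨
  map f (upTo (b ∸ a) ∷ʳ (b ∸ a))   ≡⟨ map-++ f (upTo (b ∸ a)) _ ⟩
  segment a b ∷ʳ suc (a + (b ∸ a))  ≡⟨ cong (λ m → segment a b ∷ʳ suc m) (m+[n∸m]≡n a≤b) ⟩
  segment a b ∷ʳ suc b              ∎
  where
  open ≡-Reasoning
  f = λ t → suc (a + t)

segment-++ : ∀ {a b c} → a ≤ b → b ≤′ c → segment a b ++ segment b c ≡ segment a c
segment-++ {a} {b} a≤b ≤′-refl = trans (cong (segment a b ++_) (segment-self b)) (++-identityʳ _)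
segment-++ {a} {b} {suc c} a≤b (≤′-step b≤′c) = begin
  segment a b ++ segment b (suc c)         ≡⟨ cong (segment a b ++_) (segment-∷ʳ (≤′⇒≤ b≤′c)) ⟩
  segment a b ++ (segment b c ∷ʳ suc c)    ≡⟨ ++-assoc (segment a b) _ _ ⟨
  (segment a b ++ segment b c) ∷ʳ suc c    ≡⟨ cong (_∷ʳ suc c) (segment-++ a≤b b≤′c) ⟩
  segment a c ∷ʳ suc c                     ≡⟨ segment-∷ʳ (≤-trans a≤b (≤′⇒≤ b≤′c)) ⟨
  segment a (suc c)                        ∎
  where open ≡-Reasoning

length-segment : ∀ a b → length (segment a b) ≡ b ∸ a
length-segment a b = trans (length-map _ (upTo (b ∸ a))) (length-upTo (b ∸ a))

∈-segment⁻ : ∀ {a b m} → m ∈ segment a b → InInterval a b m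
∈-segment⁻ {a} {b} m∈ with ∈-map⁻ _ m∈
... | t , t∈ , refl = s≤s (m≤m+n a t) , (begin
  suc (a + t)   ≡⟨ +-suc a t ⟨
  a + suc t     ≤⟨ +-monoʳ-≤ a t<b∸a ⟩
  a + (b ∸ a)   ≡⟨ m+[n∸m]≡n {a} (<⇒≤ (m∸n≢0⇒n<m (m<n⇒n≢0 t<b∸a))) ⟩
  b             ∎)
  where
  open ≤-Reasoning
  t<b∸a = ∈-upTo⁻ t∈

∈-segment⁺ : ∀ {a b m} → InInterval a b m → m ∈ segment a b
∈-segment⁺ {a} {b} {suc m} (a<m , m<b) =
  subst (_∈ segment a b) (cong suc (m+[n∸m]≡n (<⇒≤pred a<m)))
    (∈-map⁺ (λ t → suc (a + t)) (∈-upTo⁺ (∸-monoˡ-< m<b (<⇒≤pred a<m))))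

sum-segment-self : ∀ (g : ℕ → ℕ) a → sum (map g (segment a a)) ≡ 0
sum-segment-self g a = cong (sum ∘ map g) (segment-self a)

sum-segment-∷ʳ : ∀ (g : ℕ → ℕ) {a b} → a ≤ b →
  sum (map g (segment a (suc b))) ≡ sum (map g (segment a b)) + g (suc b)
sum-segment-∷ʳ g {a} {b} a≤b = begin
  sum (map g (segment a (suc b)))                ≡⟨ cong (sum ∘ map g) (segment-∷ʳ a≤b) ⟩
  sum (map g (segment a b ∷ʳ suc b))             ≡⟨ cong sum (map-++ g (segment a b) _) ⟩
  sum (map g (segment a b) ++ g (suc b) ∷ [])    ≡⟨ sum-++ (map g (segment a b)) _ ⟩
  sum (map g (segment a b)) + (g (suc b) + 0)    ≡⟨ cong (sum (map g (segment a b)) +_) (+-identityʳ _) ⟩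
  sum (map g (segment a b)) + g (suc b)          ∎
  where open ≡-Reasoning

-- range1 e, the columns of a row of length e, is segment 0 e by definition.
count-inInterval : ∀ {a b e} → a ≤ b → b ≤ e → count (inInterval? a b) (segment 0 e) ≡ b ∸ a
count-inInterval {a} {b} {e} a≤b b≤e = begin
  count P? (segment 0 e)
    ≡⟨ cong (count P?) (segment-++ z≤n (≤⇒≤′ (≤-trans a≤b b≤e))) ⟨
  count P? (segment 0 a ++ segment a e)
    ≡⟨ cong (λ xs → count P? (segment 0 a ++ xs)) (segment-++ a≤b (≤⇒≤′ b≤e)) ⟨
  count P? (segment 0 a ++ segment a b ++ segment b e)
    ≡⟨ count-++ P? (segment 0 a) _ ⟩
  count P? (segment 0 a) + count P? (segment a b ++ segment b e)
    ≡⟨ cong₂ _+_ (count-none P? (segment 0 a) before) (count-++ P? (segment a b) _) ⟩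
  count P? (segment a b) + count P? (segment b e)
    ≡⟨ cong₂ _+_ (count-all P? (segment a b) ∈-segment⁻) (count-none P? (segment b e) after) ⟩
  length (segment a b) + 0
    ≡⟨ trans (+-identityʳ _) (length-segment a b) ⟩
  b ∸ a ∎
  where
  open ≡-Reasoning
  P? = inInterval? a b
  before : ∀ {m} → m ∈ segment 0 a → ¬ InInterval a b m
  before m∈ (a<m , _) = <⇒≱ a<m (proj₂ (∈-segment⁻ m∈))
  after : ∀ {m} → m ∈ segment b e → ¬ InInterval a b m
  after m∈ (_ , m≤b) = <⇒≱ (proj₁ (∈-segment⁻ m∈)) m≤b

boxes-∷ : ∀ x xs → boxes (x ∷ xs) ≡ map (1 ,_) (range1 x) ++ map (map₁ suc) (boxes xs)
boxes-∷ x xs = cong (map (1 ,_) (range1 x) ++_) (begin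
  concatMap F (map suc (applyUpTo suc L))         ≡⟨ cong (concatMap F ∘ map suc) (map-upTo suc L) ⟨
  concatMap F (map suc (map suc (upTo L)))        ≡⟨ concatMap-map F suc (map suc (upTo L)) ⟩
  concatMap (F ∘ suc) (map suc (upTo L))          ≡⟨ concatMap-map (F ∘ suc) suc (upTo L) ⟩
  concatMap (F ∘ suc ∘ suc) (upTo L)              ≡⟨ concatMap-cong (λ u → map-∘ (range1 (lookupD 0 xs u))) (upTo L) ⟩
  concatMap (map (map₁ suc) ∘ G ∘ suc) (upTo L)   ≡⟨ concatMap-map (map (map₁ suc) ∘ G) suc (upTo L) ⟨
  concatMap (map (map₁ suc) ∘ G) (range1 L)       ≡⟨ map-concatMap (map₁ suc) G (range1 L) ⟨
  map (map₁ suc) (boxes xs)                       ∎)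
  where
  open ≡-Reasoning
  L = length xs
  F = λ r → map (r ,_) (range1 (entry (x ∷ xs) r))
  G = λ r → map (r ,_) (range1 (entry xs r))

∈-boxes⁺ : ∀ la {r c} → InShape la r c → (r , c) ∈ boxes la
∈-boxes⁺ la {zero} (() , _)
∈-boxes⁺ [] {suc _} (_ , s≤s _ , ())
∈-boxes⁺ (x ∷ xs) {suc zero} (_ , 1≤c , c≤x) rewrite boxes-∷ x xs =
  ∈-++⁺ˡ (∈-map⁺ (1 ,_) (∈-segment⁺ (1≤c , c≤x)))
∈-boxes⁺ (x ∷ xs) {suc (suc r)} (_ , 1≤c , c≤λ) rewrite boxes-∷ x xs =
  ∈-++⁺ʳ _ (∈-map⁺ (map₁ suc) (∈-boxes⁺ xs (s≤s z≤n , 1≤c , c≤λ)))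

∈-boxes⁻ : ∀ la {r c} → (r , c) ∈ boxes la → InShape la r c
∈-boxes⁻ (x ∷ xs) b∈ rewrite boxes-∷ x xs with ∈-++⁻ (map (1 ,_) (range1 x)) b∈
... | inj₁ b∈row₁ with ∈-map⁻ (1 ,_) b∈row₁
...   | c , c∈ , refl = s≤s z≤n , ∈-segment⁻ c∈
∈-boxes⁻ (x ∷ xs) b∈ | inj₂ b∈rest with ∈-map⁻ (map₁ suc) b∈rest
...   | (r , c) , rc∈ , refl with ∈-boxes⁻ xs rc∈
...     | s≤s _ , 1≤c , c≤λ = s≤s z≤n , 1≤c , c≤λ

count-boxes-inRow : ∀ la {r} {P : Pred (ℕ × ℕ) 0ℓ} (P? : Decidable P) → (∀ {r' c} → P (r' , c) → r' ≡ r) →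
  count P? (boxes la) ≡ count (λ c → P? (r , c)) (range1 (entry la r))
count-boxes-inRow [] {zero} P? inRow = refl
count-boxes-inRow [] {suc r} P? inRow = refl
count-boxes-inRow (x ∷ xs) {r} {P} P? inRow rewrite boxes-∷ x xs
  | count-++ P? (map (1 ,_) (range1 x)) (map (map₁ suc) (boxes xs))
  | count-map P? (1 ,_) (range1 x) | count-map P? (map₁ suc) (boxes xs) with r
... | zero = cong₂ _+_ (count-none (λ c → P? (1 , c)) (range1 x) (λ _ → 1+n≢0 ∘ inRow))
                      (count-none (P? ∘ map₁ suc) (boxes xs) (λ _ → 1+n≢0 ∘ inRow))
... | suc zero =
  trans (cong (count (λ c → P? (1 , c)) (range1 x) +_) (count-none (P? ∘ map₁ suc) (boxes xs) notInRow₁))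
        (+-identityʳ _)
  where
  notInRow₁ : ∀ {b} → b ∈ boxes xs → ¬ P (suc (proj₁ b) , proj₂ b)
  notInRow₁ b∈ p with ∈-boxes⁻ xs b∈ | inRow p
  ... | () , _ | refl
... | suc (suc r) = cong₂ _+_ (count-none (λ c → P? (1 , c)) (range1 x) (λ _ → 0≢1+n ∘ suc-injective ∘ inRow))
                              (count-boxes-inRow xs (P? ∘ map₁ suc) (suc-injective ∘ inRow))

InRowInterval : ℕ → ℕ → ℕ → Pred (ℕ × ℕ) 0ℓ
InRowInterval r a b (r' , c) = r' ≡ r × InInterval a b c

inRowInterval? : ∀ r a b → Decidable (InRowInterval r a b)
inRowInterval? r a b (r' , c) = (r' ≟ r) ×-dec inInterval? a b c

count-boxes-rowInterval : ∀ la {r a b} → a ≤ b → b ≤ entry la r →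
  count (inRowInterval? r a b) (boxes la) ≡ b ∸ a
count-boxes-rowInterval la {r} {a} {b} a≤b b≤λ = begin
  count (inRowInterval? r a b) (boxes la)
    ≡⟨ count-boxes-inRow la (inRowInterval? r a b) proj₁ ⟩
  count (λ c → inRowInterval? r a b (r , c)) (range1 (entry la r))
    ≡⟨ count-cong (λ c → inRowInterval? r a b (r , c)) (inInterval? a b) (range1 (entry la r))
                  (λ _ → mk⇔ proj₂ (refl ,_)) ⟩
  count (inInterval? a b) (segment 0 (entry la r))
    ≡⟨ count-inInterval a≤b b≤λ ⟩
  b ∸ a ∎
  where open ≡-Reasoning

Suffix : WeakComposition → ℕ → WeakComposition → Set
Suffix la k rest = ∀ t → entry la (t + k) ≡ lookupD 0 rest t

suffix-start : ∀ la → Suffix la 1 la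
suffix-start la t rewrite +-comm t 1 = refl

suffix-head : ∀ {la k v rest} → Suffix la k (v ∷ rest) → entry la k ≡ v
suffix-head s = s 0

suffix-tail : ∀ {la k v rest} → Suffix la k (v ∷ rest) → Suffix la (suc k) rest
suffix-tail {la} {k} s t = trans (cong (entry la) (+-suc t k)) (s (suc t))

suffix-[] : ∀ {la k} → Suffix la k [] → ∀ {r} → k ≤ r → entry la r ≡ 0
suffix-[] {la} {k} s {r} k≤r = trans (cong (entry la) (sym (m∸n+n≡m k≤r))) (s (r ∸ k))

Holds : Entries → ℕ → Pred (ℕ × ℕ) 0ℓ
Holds T x (r , c) = (r , c , x) ∈ T

holds? : ∀ T x → Decidable (Holds T x)
holds? T x (r , c) = (r , c , x) ∈? T

rowMaximum : ∀ (T : Entries) {r c x} → (r , c , x) ∈ T →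
  ∃[ c' ] ∃[ y ] ((r , c' , y) ∈ T × (∀ {c'' z} → (r , c'' , z) ∈ T → z ≤ y))
rowMaximum T {r} {c} {x} e∈T = proj₁ (proj₂ m) , proj₂ (proj₂ m) , m∈T , m-max
  where
  value = proj₂ ∘ proj₂
  inRow? = λ (e : ℕ × ℕ × ℕ) → proj₁ e ≟ r
  row = filter inRow? T
  m = argmax value (r , c , x) row
  m∈T : (r , proj₁ (proj₂ m) , proj₂ (proj₂ m)) ∈ T
  m∈T = let r≡ , m∈ = argmax-all value {P = λ e → proj₁ e ≡ r × e ∈ T} (refl , e∈T)
                        (All.tabulate (λ e∈row → let e′∈T , inRow = ∈-filter⁻ inRow? e∈row in inRow , e′∈T))
        in subst (λ r' → (r' , proj₂ m) ∈ T) r≡ m∈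
  m-max : ∀ {c'' z} → (r , c'' , z) ∈ T → z ≤ value m
  m-max e∈T' = All.lookup (f[xs]≤f[argmax] (r , c , x) row) (∈-filter⁺ inRow? e∈T' refl)

Section : WeakComposition → Entries → (ℕ → ℕ → ℕ) → Set
Section la T f = ∀ r c → InShape la r c → (r , c , f r c) ∈ T

update : (ℕ → ℕ → ℕ) → ℕ → ℕ → ℕ → ℕ → ℕ → ℕ
update f r c x r' c' with ≡-dec _≟_ _≟_ (r' , c') (r , c)
... | yes _ = x
... | no _  = f r' c'

update-at : ∀ f r c x → update f r c x r c ≡ x
update-at f r c x with ≡-dec _≟_ _≟_ (r , c) (r , c)
... | yes _ = refl
... | no ne = contradiction refl ne

update-away : ∀ f {r c x r' c'} → (r' , c') ≢ (r , c) → update f r c x r' c' ≡ f r' c'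
update-away f {r} {c} {x} {r'} {c'} ne with ≡-dec _≟_ _≟_ (r' , c') (r , c)
... | yes eq = contradiction eq ne
... | no _  = refl

update-section : ∀ {la T f r c x} → Section la T f → (r , c , x) ∈ T → Section la T (update f r c x)
update-section {r = r} {c} sec e∈T r' c' sh with ≡-dec _≟_ _≟_ (r' , c') (r , c)
... | yes refl = e∈T
... | no _     = sec r' c' sh

InShape? : ∀ la r c → Dec (InShape la r c)
InShape? la r c = (1 ≤? r) ×-dec (1 ≤? c) ×-dec (c ≤? entry la r)

module SetValued {la T} (sv : IsSVWCT la T) where

  entry-inShape : ∀ {r c x} → (r , c , x) ∈ T → InShape la r c
  entry-inShape e∈T = proj₁ (All.lookup (proj₁ sv) e∈T)

  entry-pos : ∀ {r c x} → (r , c , x) ∈ T → 1 ≤ x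
  entry-pos e∈T = proj₂ (All.lookup (proj₁ sv) e∈T)

  covered : ∀ r c → InShape la r c → ∃[ x ] ((r , c , x) ∈ T)
  covered = proj₁ (proj₂ sv)

  section : ℕ → ℕ → ℕ
  section r c with InShape? la r c
  ... | yes sh = proj₁ (covered r c sh)
  ... | no _   = 0

  section-ok : Section la T section
  section-ok r c sh with InShape? la r c
  ... | yes sh' = proj₂ (covered r c sh')
  ... | no ¬sh  = contradiction sh ¬sh

  section-through : ∀ {r c x r' c' y} → (r , c , x) ∈ T → (r' , c' , y) ∈ T → (r , c) ≢ (r' , c') →
    ∃[ f ] (IsWCT la f × f r c ≡ x × f r' c' ≡ y)
  section-through {r} {c} {x} {r'} {c'} {y} ex ey ne =
    f , proj₂ (proj₂ sv) f (update-section (update-section section-ok ey) ex) ,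
    update-at _ r c x , trans (update-away _ (ne ∘ sym)) (update-at section r' c' y)
    where f = update (update section r' c' y) r c x

  value≤row : ∀ {r c x} → (r , c , x) ∈ T → x ≤ r
  value≤row {r} {c} {x} e∈T with proj₂ (proj₂ sv) _ (update-section section-ok e∈T)
  ... | _ , _ , _ , bounded = subst (_≤ r) (update-at section r c x) (bounded r c (entry-inShape e∈T))

  rows-strict : ∀ {r c x r' c' y} → (r , c , x) ∈ T → (r' , c' , y) ∈ T → r < r' → x < y
  rows-strict ex ey r<r' with section-through ex ey (λ eq → <-irrefl (cong proj₁ eq) r<r')
  ... | f , (_ , _ , strict , _) , refl , refl = strict _ _ _ _ (entry-inShape ex) (entry-inShape ey) r<r'

  row-weak : ∀ {r c x c' y} → (r , c , x) ∈ T → (r , c' , y) ∈ T → c < c' → x ≤ y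
  row-weak ex ey c<c' with section-through ex ey (λ eq → <-irrefl (cong proj₂ eq) c<c')
  ... | f , (_ , mono , _ , _) , refl , refl =
    mono _ _ _ _ (entry-inShape ex) (entry-inShape ey) (inj₂ (refl , <⇒≤ c<c'))

-- From a set-valued tableau to a glide

module FromTableau {la T} (sv : IsSVWCT la T) {κ} (kt : IsKontent la T κ) where
  open SetValued sv

  kval-count : ∀ {j} → 1 ≤ j → kval κ j ≡ count (holds? T j) (boxes la)
  kval-count j≥1 = proj₁ (kt _ j≥1)

  boldAt⁺ : ∀ {j} → 1 ≤ j → kbold κ j ≡ true → BoldAt T j
  boldAt⁺ j≥1 = proj₁ (proj₂ (kt _ j≥1))

  boldAt⁻ : ∀ {j} → 1 ≤ j → BoldAt T j → kbold κ j ≡ true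
  boldAt⁻ j≥1 = proj₂ (proj₂ (kt _ j≥1))

  HoldsIn : ℕ → ℕ → Pred (ℕ × ℕ) 0ℓ
  HoldsIn a b bx = Any (λ x → Holds T x bx) (segment a b)

  holdsIn? : ∀ a b → Decidable (HoldsIn a b)
  holdsIn? a b bx = any? (λ x → holds? T x bx) (segment a b)

  module RowSegment {r a b} (a≤b : a ≤ b)
    (inside : ∀ {c x} → (r , c , x) ∈ T → InInterval a b x)
    (onlyHere : ∀ {r' c x} → (r' , c , x) ∈ T → InInterval a b x → r' ≡ r) where

    holding-earlier⇔box : ∀ {b' r' c' i} → a ≤ b' → b' < b → i < suc b' →
      (r' , suc c' , i) ∈ T → (r' , suc c' , suc b') ∈ T →
      ∀ {bx} → (HoldsIn a b' ∩ Holds T (suc b')) bx ⇔ InRowInterval r' c' (suc c') bx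
    holding-earlier⇔box {b'} {r'} {c'} {i} a≤b' b'<b i<m ei em = mk⇔ theBox fromBox
      where
      r'≡r = onlyHere em (s≤s a≤b' , b'<b)
      theBox : ∀ {bx} → (HoldsIn a b' ∩ Holds T (suc b')) bx → InRowInterval r' c' (suc c') bx
      theBox {r'' , c''} (earlier , em'') with find earlier
      ... | x , x∈ , ex with trans (onlyHere em'' (s≤s a≤b' , b'<b)) (sym r'≡r)
      ... | refl with <-cmp c'' (suc c')
      ... | tri< c''<c' _ _ = contradiction (row-weak em'' ei c''<c') (<⇒≱ i<m)
      ... | tri≈ _ refl _   = refl , ≤-refl , ≤-refl
      ... | tri> _ _ c'<c'' = contradiction (row-weak em ex c'<c'') (<⇒≱ (s≤s (proj₂ (∈-segment⁻ x∈))))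
      fromBox : ∀ {bx} → InRowInterval r' c' (suc c') bx → (HoldsIn a b' ∩ Holds T (suc b')) bx
      fromBox {r'' , c''} (refl , c'<c'' , c''≤c') with ≤-antisym c''≤c' c'<c''
      ... | refl = lose (∈-segment⁺ (a<i , ≤-pred i<m)) ei , em
        where a<i = proj₁ (inside (subst (λ r₀ → (r₀ , _ , i) ∈ T) r'≡r ei))

    count-holding-earlier : ∀ {b'} → a ≤ b' → b' < b →
      count (holdsIn? a b' ∩? holds? T (suc b')) (boxes la) ≡ boolToℕ (kbold κ (suc b'))
    count-holding-earlier {b'} a≤b' b'<b with kbold κ (suc b') in isBold
    ... | false = count-none (holdsIn? a b' ∩? holds? T (suc b')) (boxes la) notHeld
      where
      notHeld : ∀ {bx} → bx ∈ boxes la → ¬ (HoldsIn a b' ∩ Holds T (suc b')) bx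
      notHeld _ (earlier , em) =
        let x , x∈ , ex = find earlier
            boldAt = _ , _ , x , s≤s (proj₂ (∈-segment⁻ x∈)) , ex , em
        in contradiction (trans (sym isBold) (boldAt⁻ (s≤s z≤n) boldAt)) λ ()
    ... | true with boldAt⁺ (s≤s z≤n) isBold
    ...   | r' , _ , i , i<m , ei , em with entry-inShape ei
    ...   | _ , s≤s {n = c'} _ , c≤λ = begin
      count (holdsIn? a b' ∩? holds? T (suc b')) (boxes la)
        ≡⟨ count-cong (holdsIn? a b' ∩? holds? T (suc b')) (inRowInterval? r' c' (suc c')) (boxes la)
                      (λ _ → holding-earlier⇔box a≤b' b'<b i<m ei em) ⟩
      count (inRowInterval? r' c' (suc c')) (boxes la)
        ≡⟨ count-boxes-rowInterval la (n≤1+n c') c≤λ ⟩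
      suc c' ∸ c'
        ≡⟨ m+n∸n≡m 1 c' ⟩
      1 ∎
      where open ≡-Reasoning

    holdsIn-suc : ∀ {b'} → a ≤ b' → ∀ {bx} →
      HoldsIn a (suc b') bx ⇔ (HoldsIn a b' ∪ Holds T (suc b')) bx
    holdsIn-suc {b'} a≤b' rewrite segment-∷ʳ a≤b' =
      mk⇔ (Sum.map₂ (λ { (here h) → h ; (there ()) }) ∘ ++⁻ (segment a b'))
          [ ++⁺ˡ , ++⁺ʳ (segment a b') ∘ here ]′

    count-holders+excess : ∀ {b'} → a ≤′ b' → b' ≤ b →
      count (holdsIn? a b') (boxes la) + excess κ a b' ≡ segSum κ a b'
    count-holders+excess ≤′-refl _ =
      trans (cong₂ _+_ (count-none (holdsIn? a a) (boxes la) nothingHeld) (sum-segment-self _ a))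
            (sym (sum-segment-self (kval κ) a))
      where
      nothingHeld : ∀ {bx} → bx ∈ boxes la → ¬ HoldsIn a a bx
      nothingHeld _ held = let _ , x∈ , _ = find held ; a<x , x≤a = ∈-segment⁻ x∈ in <⇒≱ a<x x≤a
    count-holders+excess {suc b'} (≤′-step a≤′b') b'<b = begin
      N' + excess κ a (suc b')
        ≡⟨ cong (N' +_) (sum-segment-∷ʳ (boolToℕ ∘ kbold κ) a≤b') ⟩
      N' + (excess κ a b' + boolToℕ (kbold κ m))
        ≡⟨ x∙yz≈xz∙y N' _ _ ⟩
      N' + boolToℕ (kbold κ m) + excess κ a b'
        ≡⟨ cong (λ n → N' + n + excess κ a b') (count-holding-earlier a≤b' b'<b) ⟨
      N' + Both + excess κ a b'
        ≡⟨ cong (_+ excess κ a b') grow ⟩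
      N + kval κ m + excess κ a b'
        ≡⟨ xy∙z≈xz∙y N _ _ ⟩
      N + excess κ a b' + kval κ m
        ≡⟨ cong (_+ kval κ m) (count-holders+excess a≤′b' (<⇒≤ b'<b)) ⟩
      segSum κ a b' + kval κ m
        ≡⟨ sum-segment-∷ʳ (kval κ) a≤b' ⟨
      segSum κ a (suc b') ∎
      where
      open ≡-Reasoning
      m = suc b'
      a≤b' = ≤′⇒≤ a≤′b'
      N = count (holdsIn? a b') (boxes la)
      N' = count (holdsIn? a m) (boxes la)
      Both = count (holdsIn? a b' ∩? holds? T m) (boxes la)
      grow : N' + Both ≡ N + kval κ m
      grow = begin
        N' + Both
          ≡⟨ cong (_+ Both) (count-cong (holdsIn? a m) (holdsIn? a b' ∪? holds? T m) (boxes la)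
               (λ _ → holdsIn-suc a≤b')) ⟩
        count (holdsIn? a b' ∪? holds? T m) (boxes la) + Both
          ≡⟨ count-∪-∩ (holdsIn? a b') (holds? T m) (boxes la) ⟩
        N + count (holds? T m) (boxes la)
          ≡⟨ cong (N +_) (kval-count (s≤s z≤n)) ⟨
        N + kval κ m ∎

    count-holders-whole : count (holdsIn? a b) (boxes la) ≡ entry la r
    count-holders-whole = trans (count-cong (holdsIn? a b) (inRowInterval? r 0 (entry la r)) (boxes la)
                                  (λ bx∈ → mk⇔ (toRow bx∈) (fromRow bx∈)))
                      (count-boxes-rowInterval la z≤n ≤-refl)
      where
      toRow : ∀ {bx} → bx ∈ boxes la → HoldsIn a b bx → InRowInterval r 0 (entry la r) bx
      toRow {r' , c} bx∈ held with find held
      ... | x , x∈ , ex with onlyHere ex (∈-segment⁻ x∈)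
      ... | refl = refl , proj₂ (∈-boxes⁻ la bx∈)
      fromRow : ∀ {bx} → bx ∈ boxes la → InRowInterval r 0 (entry la r) bx → HoldsIn a b bx
      fromRow {r' , c} bx∈ (refl , _) with covered r' c (∈-boxes⁻ la bx∈)
      ... | x , ex = lose (∈-segment⁺ (inside ex)) ex

    segSum≡row+excess : segSum κ a b ≡ entry la r + excess κ a b
    segSum≡row+excess = begin
      segSum κ a b                                    ≡⟨ count-holders+excess (≤⇒≤′ a≤b) ≤-refl ⟨
      count (holdsIn? a b) (boxes la) + excess κ a b  ≡⟨ cong (_+ excess κ a b) count-holders-whole ⟩
      entry la r + excess κ a b                       ∎
      where open ≡-Reasoning

  Below : ℕ → ℕ → Set
  Below k prev = ∀ {r c x} → (r , c , x) ∈ T → r < k → x ≤ prev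

  Above : ℕ → ℕ → Set
  Above k prev = ∀ {r c x} → (r , c , x) ∈ T → k ≤ r → prev < x

  module RowCut {k prev} (1≤k : 1 ≤ k) (nonempty : 1 ≤ entry la k) (below : Below k prev) (above : Above k prev) where

    maxEntry = rowMaximum T (proj₂ (covered k 1 (1≤k , ≤-refl , nonempty)))

    i : ℕ
    i = proj₁ (proj₂ maxEntry)

    ei : (k , proj₁ maxEntry , i) ∈ T
    ei = proj₁ (proj₂ (proj₂ maxEntry))

    i-max : ∀ {c x} → (k , c , x) ∈ T → x ≤ i
    i-max = proj₂ (proj₂ (proj₂ maxEntry))

    prev<i : prev < i
    prev<i = above ei ≤-refl

    onlyHere : ∀ {r c x} → (r , c , x) ∈ T → InInterval prev i x → r ≡ k
    onlyHere {r} e (prev<x , x≤i) with <-cmp r k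
    ... | tri< r<k _ _ = contradiction (below e r<k) (<⇒≱ prev<x)
    ... | tri≈ _ r≡k _ = r≡k
    ... | tri> _ _ k<r = contradiction (rows-strict ei e k<r) (≤⇒≯ x≤i)

    segSum≡ : segSum κ prev i ≡ entry la k + excess κ prev i
    segSum≡ = RowSegment.segSum≡row+excess (<⇒≤ prev<i) (λ e → above e ≤-refl , i-max e) onlyHere

    firstNotBold : FirstNonzeroNotBold κ prev i
    firstNotBold m prev<m m≤i _ zeroBefore = ¬-not notBold
      where
      notBold : kbold κ m ≢ true
      notBold isBold with boldAt⁺ (≤-trans (s≤s z≤n) prev<m) isBold
      ... | r , c , x , x<m , ex , em with onlyHere em (prev<m , m≤i)
      ... | refl = <⇒≢ (count-pos (holds? T x) (∈-boxes⁺ la (entry-inShape ex)) ex)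
                       (trans (sym (zeroBefore x (above ex ≤-refl) x<m)) (kval-count (entry-pos ex)))

    below′ : Below (suc k) i
    below′ {r} e r≤k with m≤n⇒m<n∨m≡n (≤-pred r≤k)
    ... | inj₁ r<k  = ≤-trans (below e r<k) (<⇒≤ prev<i)
    ... | inj₂ refl = i-max e

    above′ : Above (suc k) i
    above′ e k<r = rows-strict ei e k<r

  glide-from : ∀ rest {k prev} → 1 ≤ k → Suffix la k rest → Below k prev → Above k prev →
    ∃[ cuts ] GlideCuts κ prev (npos k rest) cuts
  glide-from [] {k} {prev} _ s below _ = [] , vanish
    where
    vanish : ∀ m → prev < m → kval κ m ≡ 0
    vanish m prev<m = trans (kval-count (≤-trans (s≤s z≤n) prev<m)) (count-none (holds? T m) (boxes la) absent)
      where
      absent : ∀ {bx} → bx ∈ boxes la → ¬ Holds T m bx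
      absent {r , c} _ em with r <? k
      ... | yes r<k = <⇒≱ prev<m (below em r<k)
      ... | no r≮k with entry-inShape em
      ...   | _ , 1≤c , c≤λ = <⇒≱ 1≤c (subst (c ≤_) (suffix-[] s (≮⇒≥ r≮k)) c≤λ)
  glide-from (zero ∷ rest) {k} {prev} _ s below above =
    glide-from rest (s≤s z≤n) (suffix-tail s) below′ (λ e k<r → above e (<⇒≤ k<r))
    where
    below′ : Below (suc k) prev
    below′ {r} {c} e r≤k with m≤n⇒m<n∨m≡n (≤-pred r≤k) | entry-inShape e
    ... | inj₁ r<k  | _ = below e r<k
    ... | inj₂ refl | _ , 1≤c , c≤λ = contradiction (≤-trans 1≤c (subst (c ≤_) (suffix-head s) c≤λ)) λ ()
  glide-from (suc v ∷ rest) {k} {prev} 1≤k s below above =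
    let cuts , glideCuts = glide-from rest (s≤s z≤n) (suffix-tail s) below′ above′
    in i ∷ cuts , prev<i , subst (λ λₖ → segSum κ prev i ≡ λₖ + excess κ prev i) (suffix-head s) segSum≡ ,
       value≤row ei , firstNotBold , glideCuts
    where open RowCut 1≤k (subst (1 ≤_) (sym (suffix-head s)) (s≤s z≤n)) below above

  glide : IsGlide la κ
  glide = glide-from la ≤-refl (suffix-start la) row0-empty (λ e _ → entry-pos e)
    where
    row0-empty : Below 1 0
    row0-empty e r<1 = contradiction (≤-trans (proj₁ (entry-inShape e)) (≤-pred r<1)) λ ()

-- From a glide to a set-valued tableau

bold-nonzero : ∀ {κ} → IsWeakKomposition κ → ∀ m → kbold κ m ≡ true → kval κ m ≢ 0
bold-nonzero (nz ∷ _)  (suc zero)    = nz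
bold-nonzero (_ ∷ wk)  (suc (suc m)) = bold-nonzero wk (suc m)

module Filling {κ : WeakKomposition} (wk : IsWeakKomposition κ) where

  bold : ℕ → ℕ
  bold m = boolToℕ (kbold κ m)

  net : ℕ → ℕ
  net m = kval κ m ∸ bold m

  fill : ℕ → ℕ → ℕ
  fill a m = sum (map net (segment a m))

  -- In a piece starting after a, value m occupies the columns (gap a m , fill a m] of its row:
  -- a bold value starts in the last column of its predecessor.
  gap : ℕ → ℕ → ℕ
  gap a m = fill a (pred m) ∸ bold m

  bold≤1 : ∀ m → bold m ≤ 1
  bold≤1 m with kbold κ m
  ... | true  = ≤-refl
  ... | false = z≤n

  kval-split : ∀ m → kval κ m ≡ net m + bold m
  kval-split m with kbold κ m in b
  ... | true  = sym (m∸n+n≡m (n≢0⇒n>0 (bold-nonzero wk m b)))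
  ... | false = sym (+-identityʳ _)

  fill-suc : ∀ {a p} → a ≤ p → fill a (suc p) ≡ fill a p + net (suc p)
  fill-suc = sum-segment-∷ʳ net

  fill-mono : ∀ {a p q} → a ≤ p → p ≤′ q → fill a p ≤ fill a q
  fill-mono a≤p ≤′-refl = ≤-refl
  fill-mono {a} {p} {suc q} a≤p (≤′-step p≤′q) = begin
    fill a p            ≤⟨ fill-mono a≤p p≤′q ⟩
    fill a q            ≤⟨ m≤m+n _ _ ⟩
    fill a q + net (suc q) ≡⟨ fill-suc (≤-trans a≤p (≤′⇒≤ p≤′q)) ⟨
    fill a (suc q)      ∎
    where open ≤-Reasoning

  fill+excess : ∀ {a b} → a ≤′ b → fill a b + excess κ a b ≡ segSum κ a b
  fill+excess {a} ≤′-refl rewrite segment-self a = refl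
  fill+excess {a} {suc b} (≤′-step a≤′b) = begin
    fill a (suc b) + excess κ a (suc b)
      ≡⟨ cong₂ _+_ (fill-suc a≤b) (sum-segment-∷ʳ bold a≤b) ⟩
    (fill a b + net (suc b)) + (excess κ a b + bold (suc b))
      ≡⟨ interchange (fill a b) _ _ _ ⟩
    (fill a b + excess κ a b) + (net (suc b) + bold (suc b))
      ≡⟨ cong₂ _+_ (fill+excess a≤′b) (sym (kval-split (suc b))) ⟩
    segSum κ a b + kval κ (suc b)
      ≡⟨ sum-segment-∷ʳ (kval κ) a≤b ⟨
    segSum κ a (suc b) ∎
    where
    open ≡-Reasoning
    a≤b = ≤′⇒≤ a≤′b

  fill≡0⇒kval≡0 : ∀ {a b p} → FirstNonzeroNotBold κ a b → a ≤′ p → p ≤ b → fill a p ≡ 0 →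
    ∀ {m} → InInterval a p m → kval κ m ≡ 0
  fill≡0⇒kval≡0 _ ≤′-refl _ _ (a<m , m≤a) = contradiction m≤a (<⇒≱ a<m)
  fill≡0⇒kval≡0 {a} {b} {suc p} firstNB (≤′-step a≤′p) p<b fill≡0 (a<m , m≤p+1) =
    [ (λ m≤p → earlierZero (a<m , ≤-pred m≤p)) , (λ { refl → lastZero }) ]′ (m≤n⇒m<n∨m≡n m≤p+1)
    where
    a≤p = ≤′⇒≤ a≤′p
    parts≡0 : fill a p + net (suc p) ≡ 0
    parts≡0 = trans (sym (fill-suc a≤p)) fill≡0
    earlierZero : ∀ {m'} → InInterval a p m' → kval κ m' ≡ 0
    earlierZero = fill≡0⇒kval≡0 firstNB a≤′p (<⇒≤ p<b) (m+n≡0⇒m≡0 _ parts≡0)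
    lastZero : kval κ (suc p) ≡ 0
    lastZero with kval κ (suc p) ≟ 0
    ... | yes kval≡0 = kval≡0
    ... | no kval≢0 = contradiction (begin
      kval κ (suc p)              ≡⟨ kval-split (suc p) ⟩
      net (suc p) + bold (suc p)  ≡⟨ cong₂ _+_ (m+n≡0⇒n≡0 (fill a p) parts≡0) (cong boolToℕ notBold) ⟩
      0                           ∎) kval≢0
      where
      open ≡-Reasoning
      notBold = firstNB (suc p) (s≤s a≤p) p<b kval≢0 (λ m' a<m' m'<m → earlierZero (a<m' , ≤-pred m'<m))

  fill-before-bold-pos : ∀ {a b m} → FirstNonzeroNotBold κ a b → InInterval a b m → kbold κ m ≡ true →
    1 ≤ fill a (pred m)
  fill-before-bold-pos {a} {b} {suc p} firstNB (a<m , m≤b) isBold with fill a p ≟ 0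
  ... | no fill≢0 = n≢0⇒n>0 fill≢0
  ... | yes fill≡0 = contradiction (trans (sym isBold) notBold) λ ()
    where
    earlierZero = fill≡0⇒kval≡0 firstNB (≤⇒≤′ (≤-pred a<m)) (<⇒≤ m≤b) fill≡0
    notBold = firstNB (suc p) a<m m≤b (bold-nonzero wk (suc p) isBold)
                      (λ m' a<m' m'<m → earlierZero (a<m' , ≤-pred m'<m))

  bold≤fill-before : ∀ {a b m} → FirstNonzeroNotBold κ a b → InInterval a b m → bold m ≤ fill a (pred m)
  bold≤fill-before {m = m} firstNB m∈ab with kbold κ m in isBold
  ... | true  = fill-before-bold-pos firstNB m∈ab isBold
  ... | false = z≤n

  width : ∀ {a b m} → FirstNonzeroNotBold κ a b → InInterval a b m → fill a m ∸ gap a m ≡ kval κ m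
  width {a} {b} {suc p} firstNB m∈ab@(a<m , _) = begin
    fill a (suc p) ∸ (F ∸ β)            ≡⟨ cong (_∸ (F ∸ β)) (fill-suc (≤-pred a<m)) ⟩
    F + n ∸ (F ∸ β)                     ≡⟨ cong (λ x → x + n ∸ (F ∸ β)) (m∸n+n≡m β≤F) ⟨
    (F ∸ β + β) + n ∸ (F ∸ β)           ≡⟨ cong (_∸ (F ∸ β)) (+-assoc (F ∸ β) β n) ⟩
    (F ∸ β) + (β + n) ∸ (F ∸ β)         ≡⟨ m+n∸m≡n (F ∸ β) (β + n) ⟩
    β + n                               ≡⟨ +-comm β n ⟩
    n + β                               ≡⟨ kval-split (suc p) ⟨
    kval κ (suc p)                      ∎
    where
    open ≡-Reasoning
    F = fill a p
    n = net (suc p)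
    β = bold (suc p)
    β≤F = bold≤fill-before firstNB m∈ab

  gap≤fill : ∀ {a m} → a < m → gap a m ≤ fill a m
  gap≤fill {a} {suc p} a<m = begin
    fill a p ∸ bold (suc p)   ≤⟨ m∸n≤m (fill a p) (bold (suc p)) ⟩
    fill a p                  ≤⟨ fill-mono (≤-pred a<m) (≤′-step ≤′-refl) ⟩
    fill a (suc p)            ∎
    where open ≤-Reasoning

  fill-before≤suc-gap : ∀ a m → fill a (pred m) ≤ suc (gap a m)
  fill-before≤suc-gap a m = begin
    fill a (pred m)                  ≤⟨ m≤n+m∸n _ (bold m) ⟩
    bold m + gap a m                 ≤⟨ +-monoˡ-≤ (gap a m) (bold≤1 m) ⟩
    suc (gap a m)                    ∎
    where open ≤-Reasoning

  gap<fill-before : ∀ {a m} → kbold κ m ≡ true → 1 ≤ fill a (pred m) → gap a m < fill a (pred m)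
  gap<fill-before {a} {m} isBold 1≤F =
    subst (λ β → fill a (pred m) ∸ boolToℕ β < fill a (pred m)) (sym isBold) (∸-monoʳ-< (s≤s z≤n) 1≤F)

  gap≡fill-before : ∀ {a m} → kbold κ m ≡ false → gap a m ≡ fill a (pred m)
  gap≡fill-before {a} {m} notBold = cong (λ β → fill a (pred m) ∸ boolToℕ β) notBold

  column-value : ∀ {a b c} → a ≤′ b → 0 < c → c ≤ fill a b →
    ∃[ m ] (InInterval a b m × InInterval (gap a m) (fill a m) c)
  column-value {a} ≤′-refl c>0 c≤fill rewrite segment-self a = contradiction c≤fill (<⇒≱ c>0)
  column-value {a} {suc b} {c} (≤′-step a≤′b) c>0 c≤fill with c ≤? fill a b
  ... | yes c≤fillb =
    let m , (a<m , m≤b) , c∈m = column-value a≤′b c>0 c≤fillb in m , (a<m , m≤n⇒m≤1+n m≤b) , c∈m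
  ... | no c≰fillb =
    suc b , (s≤s (≤′⇒≤ a≤′b) , ≤-refl) , (≤-<-trans (m∸n≤m _ (bold (suc b))) (≰⇒> c≰fillb) , c≤fill)

record Piece : Set where
  constructor piece
  field
    row lo hi : ℕ
open Piece

pieces : ℕ → List (ℕ × ℕ) → List ℕ → List Piece
pieces prev ((n , _) ∷ ns) (i ∷ is) = piece n prev i ∷ pieces i ns is
pieces _    _              _        = []

allPairs-compare : ∀ {A : Set} {R : A → A → Set} {xs x y} → AllPairs R xs → x ∈ xs → y ∈ xs →
  x ≡ y ⊎ R x y ⊎ R y x
allPairs-compare (_ ∷ _)    (here refl) (here refl) = inj₁ refl
allPairs-compare (rx ∷ _)   (here refl) (there y∈)  = inj₂ (inj₁ (All.lookup rx y∈))
allPairs-compare (rx ∷ _)   (there x∈)  (here refl) = inj₂ (inj₂ (All.lookup rx x∈))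
allPairs-compare (_ ∷ rxs)  (there x∈)  (there y∈)  = allPairs-compare rxs x∈ y∈

module ToTableau {la : WeakComposition} {κ : WeakKomposition} (wk : IsWeakKomposition κ) where
  open Filling wk

  Values : Piece → Pred ℕ 0ℓ
  Values p = InInterval (lo p) (hi p)

  record ValidPiece (p : Piece) : Set where
    field
      nonempty     : lo p < hi p
      hi≤row       : hi p ≤ row p
      fills-row    : fill (lo p) (hi p) ≡ entry la (row p)
      firstNotBold : FirstNonzeroNotBold κ (lo p) (hi p)

  Before : Piece → Piece → Set
  Before p q = row p < row q × hi p ≤ lo q

  record GlidePieces (k prev : ℕ) (ps : List Piece) : Set where
    field
      valid   : All ValidPiece ps
      sorted  : AllPairs Before ps
      bounded : All (λ p → k ≤ row p × prev ≤ lo p) ps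
      values  : ∀ {m} → prev < m → kval κ m ≢ 0 → Any (λ p → Values p m) ps
      rows    : ∀ {r} → k ≤ r → entry la r ≢ 0 → Any (λ p → row p ≡ r) ps

  glidePieces : ∀ rest {k prev cuts} → Suffix la k rest → GlideCuts κ prev (npos k rest) cuts →
    GlidePieces k prev (pieces prev (npos k rest) cuts)
  glidePieces [] {cuts = []} s vanish = record
    { valid = [] ; sorted = [] ; bounded = []
    ; values = λ prev<m → contradiction (vanish _ prev<m)
    ; rows = λ k≤r → contradiction (suffix-[] s k≤r) }
  glidePieces (zero ∷ rest) {k} s cuts = record
    { valid = valid ; sorted = sorted ; values = values
    ; bounded = All.map (Product.map₁ (≤-trans (n≤1+n k))) bounded
    ; rows = rows′ }
    where
    open GlidePieces (glidePieces rest (suffix-tail s) cuts)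
    rows′ : ∀ {r} → k ≤ r → entry la r ≢ 0 → Any (λ p → row p ≡ r) _
    rows′ k≤r with m≤n⇒m<n∨m≡n k≤r
    ... | inj₁ k<r  = rows k<r
    ... | inj₂ refl = contradiction (suffix-head s)
  glidePieces (suc v ∷ rest) {k} {prev} {i ∷ _} s (prev<i , segSum≡ , i≤k , firstNB , cuts) = record
    { valid   = head-valid ∷ valid
    ; sorted  = bounded ∷ sorted
    ; bounded = (≤-refl , ≤-refl) ∷ All.map (Product.map (≤-trans (n≤1+n k)) (≤-trans (<⇒≤ prev<i))) bounded
    ; values  = values′
    ; rows    = rows′ }
    where
    open GlidePieces (glidePieces rest (suffix-tail s) cuts)
    head-valid : ValidPiece (piece k prev i)
    head-valid = record
      { nonempty = prev<i ; hi≤row = i≤k ; firstNotBold = firstNB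
      ; fills-row = +-cancelʳ-≡ (excess κ prev i) _ _ (begin
          fill prev i + excess κ prev i   ≡⟨ fill+excess (≤⇒≤′ (<⇒≤ prev<i)) ⟩
          segSum κ prev i                 ≡⟨ segSum≡ ⟩
          suc v + excess κ prev i         ≡⟨ cong (_+ excess κ prev i) (suffix-head s) ⟨
          entry la k + excess κ prev i    ∎) }
      where open ≡-Reasoning
    values′ : ∀ {m} → prev < m → kval κ m ≢ 0 → Any (λ p → Values p m) (piece k prev i ∷ _)
    values′ {m} prev<m kval≢0 with m ≤? i
    ... | yes m≤i = here (prev<m , m≤i)
    ... | no m≰i  = there (values (≰⇒> m≰i) kval≢0)
    rows′ : ∀ {r} → k ≤ r → entry la r ≢ 0 → Any (λ p → row p ≡ r) (piece k prev i ∷ _)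
    rows′ k≤r λ≢0 with m≤n⇒m<n∨m≡n k≤r
    ... | inj₁ k<r  = there (rows k<r λ≢0)
    ... | inj₂ refl = here refl

  module Tableau {ps} (gp : GlidePieces 1 0 ps) where
    open GlidePieces gp

    PlacedIn : Piece → Pred (ℕ × ℕ × ℕ) 0ℓ
    PlacedIn p (r , c , m) = row p ≡ r × Values p m × InInterval (gap (lo p) m) (fill (lo p) m) c

    Placed : Pred (ℕ × ℕ × ℕ) 0ℓ
    Placed e = Any (λ p → PlacedIn p e) ps

    placed? : Decidable Placed
    placed? (r , c , m) = any? (λ p → (row p ≟ r) ×-dec inInterval? _ _ m ×-dec inInterval? _ _ c) ps

    candidatesAt : ℕ × ℕ → Entries
    candidatesAt (r , c) = map (λ m → (r , c , m)) (range1 r)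

    candidates : Entries
    candidates = concatMap candidatesAt (boxes la)

    tableau : Entries
    tableau = filter placed? candidates

    compare : ∀ {p q} → p ∈ ps → q ∈ ps → p ≡ q ⊎ Before p q ⊎ Before q p
    compare = allPairs-compare sorted

    same-values : ∀ {p q m} → p ∈ ps → q ∈ ps → Values p m → Values q m → p ≡ q
    same-values p∈ q∈ (lop<m , m≤hip) (loq<m , m≤hiq) with compare p∈ q∈
    ... | inj₁ p≡q                 = p≡q
    ... | inj₂ (inj₁ (_ , hip≤loq)) = contradiction (≤-trans m≤hip hip≤loq) (<⇒≱ loq<m)
    ... | inj₂ (inj₂ (_ , hiq≤lop)) = contradiction (≤-trans m≤hiq hiq≤lop) (<⇒≱ lop<m)

    same-row : ∀ {p q} → p ∈ ps → q ∈ ps → row p ≡ row q → p ≡ q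
    same-row p∈ q∈ rows≡ with compare p∈ q∈
    ... | inj₁ p≡q             = p≡q
    ... | inj₂ (inj₁ (p<q , _)) = contradiction rows≡ (<⇒≢ p<q)
    ... | inj₂ (inj₂ (q<p , _)) = contradiction (sym rows≡) (<⇒≢ q<p)

    lower-row-before : ∀ {p q} → p ∈ ps → q ∈ ps → row p < row q → hi p ≤ lo q
    lower-row-before p∈ q∈ p<q with compare p∈ q∈
    ... | inj₁ refl              = contradiction p<q (<-irrefl refl)
    ... | inj₂ (inj₁ (_ , hi≤lo)) = hi≤lo
    ... | inj₂ (inj₂ (q<p , _))  = contradiction p<q (<⇒≯ q<p)

    fill≤row : ∀ {p m} → p ∈ ps → Values p m → fill (lo p) m ≤ entry la (row p)
    fill≤row p∈ (lo<m , m≤hi) =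
      ≤-trans (fill-mono (<⇒≤ lo<m) (≤⇒≤′ m≤hi)) (≤-reflexive (ValidPiece.fills-row (All.lookup valid p∈)))

    placedIn-shape : ∀ {p r c m} → p ∈ ps → PlacedIn p (r , c , m) → InShape la r c × InInterval 0 r m
    placedIn-shape p∈ (refl , m∈@(lo<m , m≤hi) , (gap<c , c≤fill)) =
      (≤-trans (s≤s z≤n) (≤-trans nonempty hi≤row) , ≤-trans (s≤s z≤n) gap<c , ≤-trans c≤fill (fill≤row p∈ m∈)) ,
      (≤-trans (s≤s z≤n) lo<m , ≤-trans m≤hi hi≤row)
      where open ValidPiece (All.lookup valid p∈)

    ∈-tableau⁺ : ∀ {e} → Placed e → e ∈ tableau
    ∈-tableau⁺ {r , c , m} placed with find placed
    ... | p , p∈ , placedIn with placedIn-shape p∈ placedIn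
    ...   | sh , m∈ = ∈-filter⁺ placed? (∈-concatMap⁺ candidatesAt (lose (∈-boxes⁺ la sh) m∈candidatesAt)) placed
      where m∈candidatesAt = ∈-map⁺ (λ m → (r , c , m)) (∈-segment⁺ m∈)

    ∈-tableau⁻ : ∀ {e} → e ∈ tableau → Placed e
    ∈-tableau⁻ e∈ = proj₂ (∈-filter⁻ placed? {xs = candidates} e∈)

    placed-shape : ∀ {r c m} → Placed (r , c , m) → InShape la r c × InInterval 0 r m
    placed-shape placed = let _ , p∈ , placedIn = find placed in placedIn-shape p∈ placedIn

    placed-rows-strict : ∀ {r c x r' c' y} → Placed (r , c , x) → Placed (r' , c' , y) → r < r' → x < y
    placed-rows-strict px py r<r' with find px | find py
    ... | p , p∈ , (refl , (_ , x≤hi) , _) | q , q∈ , (refl , (lo<y , _) , _) =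
      ≤-<-trans (≤-trans x≤hi (lower-row-before p∈ q∈ r<r')) lo<y

    placed-row-weak : ∀ {r c x c' y} → Placed (r , c , x) → Placed (r , c' , y) → c < c' → x ≤ y
    placed-row-weak {c = c} {x} {c'} {y} px py c<c' with find px | find py
    ... | p , p∈ , (refl , (lo<x , _) , (gap<c , _)) | q , q∈ , (rows≡ , (lo<y , _) , (_ , c'≤fill))
      with same-row p∈ q∈ (sym rows≡)
    ... | refl with x ≤? y
    ...   | yes x≤y = x≤y
    ...   | no x≰y = contradiction c<c' (≤⇒≯ (begin
      c'                       ≤⟨ c'≤fill ⟩
      fill (lo p) y            ≤⟨ fill-mono (<⇒≤ lo<y) (≤⇒≤′ (<⇒≤pred (≰⇒> x≰y))) ⟩
      fill (lo p) (pred x)     ≤⟨ fill-before≤suc-gap (lo p) x ⟩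
      suc (gap (lo p) x)       ≤⟨ gap<c ⟩
      c                        ∎))
      where open ≤-Reasoning

    isWCT : ∀ f → Section la tableau f → IsWCT la f
    isWCT f sec = positive , mono , strict , ≤row
      where
      placedAt : ∀ r c → InShape la r c → Placed (r , c , f r c)
      placedAt r c sh = ∈-tableau⁻ (sec r c sh)
      positive : ∀ r c → InShape la r c → 1 ≤ f r c
      positive r c sh = proj₁ (proj₂ (placed-shape (placedAt r c sh)))
      strict : ∀ r c r' c' → InShape la r c → InShape la r' c' → r < r' → f r c < f r' c'
      strict r c r' c' sh sh' = placed-rows-strict (placedAt r c sh) (placedAt r' c' sh')
      mono : ∀ r c r' c' → InShape la r c → InShape la r' c' → BoxLe r c r' c' → f r c ≤ f r' c'
      mono r c r' c' sh sh' (inj₁ r<r') = <⇒≤ (strict r c r' c' sh sh' r<r')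
      mono r c r c' sh sh' (inj₂ (refl , c≤c')) with m≤n⇒m<n∨m≡n c≤c'
      ... | inj₁ c<c' = placed-row-weak (placedAt r c sh) (placedAt r c' sh') c<c'
      ... | inj₂ refl = ≤-refl
      ≤row : ∀ r c → InShape la r c → f r c ≤ r
      ≤row r c sh = proj₂ (proj₂ (placed-shape (placedAt r c sh)))

    covered : ∀ r c → InShape la r c → ∃[ m ] ((r , c , m) ∈ tableau)
    covered r c sh@(1≤r , 1≤c , c≤λ) with find (rows 1≤r (λ λ≡0 → <⇒≱ 1≤c (subst (c ≤_) λ≡0 c≤λ)))
    ... | p , p∈ , refl with column-value (≤⇒≤′ (<⇒≤ nonempty)) 1≤c (subst (c ≤_) (sym fills-row) c≤λ)
      where open ValidPiece (All.lookup valid p∈)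
    ...   | m , m∈ , c∈ = m , ∈-tableau⁺ (lose p∈ (refl , m∈ , c∈))

    isSVWCT : IsSVWCT la tableau
    isSVWCT = All.tabulate inShape , covered , isWCT
      where
      inShape : ∀ {e} → e ∈ tableau → InShape la (proj₁ e) (proj₁ (proj₂ e)) × (1 ≤ proj₂ (proj₂ e))
      inShape e∈ = let sh , (0<m , _) = placed-shape (∈-tableau⁻ e∈) in sh , 0<m

    holds-iff : ∀ {p j} → p ∈ ps → Values p j → ∀ {bx} →
      Holds tableau j bx ⇔ InRowInterval (row p) (gap (lo p) j) (fill (lo p) j) bx
    holds-iff {p} {j} p∈ j∈p {r , c} = mk⇔ to from
      where
      to : Holds tableau j (r , c) → InRowInterval (row p) (gap (lo p) j) (fill (lo p) j) (r , c)
      to h with find (∈-tableau⁻ h)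
      ... | q , q∈ , (rows≡ , j∈q , c∈) with same-values p∈ q∈ j∈p j∈q
      ... | refl = sym rows≡ , c∈
      from : InRowInterval (row p) (gap (lo p) j) (fill (lo p) j) (r , c) → Holds tableau j (r , c)
      from (refl , c∈) = ∈-tableau⁺ (lose p∈ (refl , j∈p , c∈))

    kval-count : ∀ {j} → 1 ≤ j → kval κ j ≡ count (holds? tableau j) (boxes la)
    kval-count {j} j≥1 with any? (λ p → inInterval? (lo p) (hi p) j) ps
    ... | yes j∈some = let p , p∈ , j∈p@(lo<j , _) = find j∈some in begin
      kval κ j
        ≡⟨ width (ValidPiece.firstNotBold (All.lookup valid p∈)) j∈p ⟨
      fill (lo p) j ∸ gap (lo p) j
        ≡⟨ count-boxes-rowInterval la (gap≤fill lo<j) (fill≤row p∈ j∈p) ⟨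
      count (inRowInterval? (row p) (gap (lo p) j) (fill (lo p) j)) (boxes la)
        ≡⟨ count-cong (holds? tableau j) (inRowInterval? (row p) _ _) (boxes la) (λ _ → holds-iff p∈ j∈p) ⟨
      count (holds? tableau j) (boxes la) ∎
      where open ≡-Reasoning
    ... | no j∉ = trans kval≡0 (sym (count-none (holds? tableau j) (boxes la) notHeld))
      where
      kval≡0 : kval κ j ≡ 0
      kval≡0 with kval κ j ≟ 0
      ... | yes kval≡0 = kval≡0
      ... | no kval≢0 = contradiction (values j≥1 kval≢0) j∉
      notHeld : ∀ {bx} → bx ∈ boxes la → ¬ Holds tableau j bx
      notHeld _ h = let q , q∈ , (_ , j∈q , _) = find (∈-tableau⁻ h) in j∉ (lose q∈ j∈q)

    boldAt⁺ : ∀ {j} → kbold κ j ≡ true → BoldAt tableau j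
    boldAt⁺ {j@(suc j′)} isBold with find (values (s≤s z≤n) (bold-nonzero wk j isBold))
    ... | p , p∈ , j∈p@(lo<j , j≤hi) with fill-before-bold-pos firstNotBold j∈p isBold
      where open ValidPiece (All.lookup valid p∈)
    ...   | 1≤c with column-value (≤⇒≤′ (≤-pred lo<j)) 1≤c ≤-refl
    ...     | m , (lo<m , m≤j′) , c∈m =
      row p , fill (lo p) j′ , m , s≤s m≤j′ ,
      ∈-tableau⁺ (lose p∈ (refl , (lo<m , ≤-trans (m≤n⇒m≤1+n m≤j′) j≤hi) , c∈m)) ,
      ∈-tableau⁺ (lose p∈ (refl , j∈p , gap<fill-before {lo p} isBold 1≤c , c≤fill))
      where c≤fill = fill-mono (≤-pred lo<j) (≤′-step ≤′-refl)

    boldAt⁻ : ∀ {j} → BoldAt tableau j → kbold κ j ≡ true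
    boldAt⁻ {j} (r , c , x , x<j , ex , ej) with find (∈-tableau⁻ ex) | find (∈-tableau⁻ ej)
    ... | q , q∈ , (refl , (lo<x , _) , (_ , c≤fill)) | p , p∈ , (rows≡ , _ , (gap<c , _))
      with same-row q∈ p∈ (sym rows≡)
    ... | refl = ¬-not λ notBold → contradiction gap<c (≤⇒≯ (begin
      c                        ≤⟨ c≤fill ⟩
      fill (lo q) x            ≤⟨ fill-mono (<⇒≤ lo<x) (≤⇒≤′ (<⇒≤pred x<j)) ⟩
      fill (lo q) (pred j)     ≡⟨ gap≡fill-before {lo q} {j} notBold ⟨
      gap (lo q) j             ∎))
      where open ≤-Reasoning

    isKontent : IsKontent la tableau κ
    isKontent j j≥1 = kval-count j≥1 , boldAt⁺ , boldAt⁻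

mainTheorem9 : (la : WeakComposition) (κ : WeakKomposition) → IsWeakKomposition κ →
    (∃[ T ] (IsSVWCT la T × IsKontent la T κ)) ⇔ IsGlide la κ
mainTheorem9 la κ wk = mk⇔
  (λ (_ , sv , kt) → FromTableau.glide sv kt)
  (λ (_ , cuts) → let open ToTableau {la} wk
                      open Tableau (glidePieces la (suffix-start la) cuts)
                  in tableau , isSVWCT , isKontent)
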